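{- Let $V\subseteq \mathrm{GF}(2)^E$ and $V'\subseteq \mathrm{GF}(2)^{E'}$ be pedestrian subspaces (for finite sets $E,E'$). Then the matroid $M(V)$ is isomorphic to $M(V')$ if and only if the graph $G_V$ is isomorphic to $G_{V'}$.
   Context: For $v\in\mathrm{GF}(2)^E$, $\mathrm{supp}(v)=\{e: v_e\neq0\}$; $M(V)$ is the matroid on $E$ whose independent sets are the $F\subseteq E$ such that no nonzero $v\in V$ has $\mathrm{supp}(v)\subseteq F$. With $b(x,y)=\sum_e x_ey_e$ and $V^\perp=\{w:b(w,v)=0\ \forall v\in V\}$, $V$ is pedestrian if $V\cap V^\perp=\{0\}$. Then $\mathrm{GF}(2)^E=V\oplus V^\perp$ and $\pi_V:\mathrm{GF}(2)^E\to V$ is the linear projection with $\pi_V(x)\in V$ and $x-\pi_V(x)\in V^\perp$; $Q_V$ is the $E\times E$ matrix with $\pi_V(x)=Q_Vx$. $G_V$ is the support graph of $Q_V$: vertex set $E$ and edge set $\{ef : (Q_V)_{ef}\neq 0\}$, where $e,f\in E$ range over all pairs including $e=f$ (so there is a loop at $e$ exactly when $(Q_V)_{ee}\neq0$). -}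

module Defs where

open import Data.Bool using (Bool; true; false; _xor_; _∧_)
open import Data.Nat using (ℕ)
open import Data.Fin using (Fin)
open import Data.Fin.Subset using (Subset; _⊆_)
open import Data.Vec using (Vec; zipWith; foldr; replicate; tabulate; lookup)
open import Data.Product using (Σ; _×_)
open import Relation.Binary.PropositionalEquality using (_≡_; _≢_)
open import Relation.Nullary using (¬_)
open import Function.Bundles using (_↔_; Inverse; _⇔_)

-- GF(2) is Bool with xor as addition and ∧ as multiplication.
-- Vectors in GF(2)^E for E = Fin n are Vec Bool n.
GF2^ : ℕ → Set
GF2^ n = Vec Bool n

0v : ∀ {n} → GF2^ n
0v = replicate _ false

_+v_ : ∀ {n} → GF2^ n → GF2^ n → GF2^ n
_+v_ = zipWith _xor_

b : ∀ {n} → GF2^ n → GF2^ n → Bool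
b x y = foldr _ _xor_ false (zipWith _∧_ x y)

-- A subspace of GF(2)^n, given by its (decidable) membership predicate.
-- Over GF(2), closure under 0 and + is exactly closure under linear combinations.
record Subspace (n : ℕ) : Set where
  field
    mem   : GF2^ n → Bool
    mem-0 : mem 0v ≡ true
    mem-+ : ∀ x y → mem x ≡ true → mem y ≡ true → mem (x +v y) ≡ true
open Subspace public

_∈V_ : ∀ {n} → GF2^ n → Subspace n → Set
x ∈V V = mem V x ≡ true

_∈V⊥_ : ∀ {n} → GF2^ n → Subspace n → Set
x ∈V⊥ V = ∀ v → v ∈V V → b x v ≡ false

Pedestrian : ∀ {n} → Subspace n → Set
Pedestrian V = ∀ v → v ∈V V → v ∈V⊥ V → v ≡ 0v

-- supp(v) as a subset of Fin n is the indicator vector v itself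
supp : ∀ {n} → GF2^ n → Subset n
supp v = v

Independent : ∀ {n} → Subspace n → Subset n → Set
Independent V F = ∀ v → v ∈V V → v ≢ 0v → ¬ (supp v ⊆ F)

Matrix : ℕ → Set
Matrix n = Fin n → Fin n → Bool

_·_ : ∀ {n} → Matrix n → GF2^ n → GF2^ n
Q · x = tabulate (λ i → b (tabulate (Q i)) x)

-- Q is the matrix Q_V of the projection π_V : GF(2)^E = V ⊕ V^⊥ → V,
-- i.e. π_V(x) = Q x satisfies π_V(x) ∈ V and x - π_V(x) ∈ V^⊥
-- (for pedestrian V such a matrix exists and is unique).
IsProjectionMatrix : ∀ {n} → Subspace n → Matrix n → Set
IsProjectionMatrix V Q = ∀ x → ((Q · x) ∈V V) × ((x +v (Q · x)) ∈V⊥ V)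

image : ∀ {n m} → Fin n ↔ Fin m → Subset n → Subset m
image σ F = tabulate (λ j → lookup F (Inverse.from σ j))

MatroidIso : ∀ {n m} → Subspace n → Subspace m → Set
MatroidIso V V' = Σ (Fin _ ↔ Fin _) λ σ →
  ∀ F → Independent V F ⇔ Independent V' (image σ F)

-- support graph G_Q: vertex set Fin n, edge ef iff Q_ef ≠ 0 (loops allowed)
Edge : ∀ {n} → Matrix n → Fin n → Fin n → Set
Edge Q e f = Q e f ≡ true

GraphIso : ∀ {n m} → Matrix n → Matrix m → Set
GraphIso Q Q' = Σ (Fin _ ↔ Fin _) λ σ →
  ∀ e f → Edge Q e f ⇔ Edge Q' (Inverse.to σ e) (Inverse.to σ f)

-- Both isomorphism notions are witnessed by a bijection σ : E ↔ E', and we show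
-- that for a fixed σ each of them is equivalent to the statement that σ
-- "relabels" V onto V', i.e. the coordinate permutation induced by σ maps V
-- into V' and its inverse maps V' into V.
--
--  * Matroid side.  A relabelling obviously transports independent sets.
--    Conversely, a matroid isomorphism maps V into V' by strong induction on
--    the size of the support: a vector whose image falls outside V' can not be
--    split as w + (v + w) with w, v + w ∈ V of smaller support, so v is a
--    circuit vector, and the image of a circuit vector lies in V' because σ
--    preserves dependence of its support.
--  * Graph side.  Over GF(2) a graph isomorphism for the support graphs is
--    exactly the equation Q' = σ Q σ⁻¹.  Since V is the fixed space of its
--    projection, such a conjugation relabels V onto V'; conversely, relabelling
--    V onto V' turns Q into a projection matrix of V', which by uniqueness of
--    the projection for pedestrian V' is Q'.

module Submission where

open import Defs
open import Data.Nat using (ℕ)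
open import Function.Bundles using (_⇔_)

open import Data.Bool using (true; false; _xor_; _∧_)
import Data.Bool as Bool
open import Data.Bool.Properties as BoolP
  using (xor-same; xor-assoc; xor-identityˡ; xor-identityʳ; ∧-distribʳ-xor; ∧-identityʳ; ∧-zeroʳ; ⇔→≡)
open import Data.Nat using (_<_; s≤s)
open import Data.Nat.Induction using (<-rec)
open import Data.Fin using (Fin; zero; suc)
open import Data.Fin.Subset using (Subset; _⊆_; ∣_∣)
open import Data.Fin.Subset.Properties using (⊆-refl; ⊆-trans; ⊆-antisym; drop-∷-⊆; p⊆q⇒∣p∣≤∣q∣)
open import Data.Vec using ([]; _∷_; tabulate; lookup; here)
open import Data.Vec.Properties
  using (lookup∘tabulate; tabulate∘lookup; tabulate-cong; lookup-zipWith; lookup-replicate;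
         []=⇒lookup; lookup⇒[]=; zipWith-assoc; zipWith-identityˡ; zipWith-identityʳ; ≡-dec)
open import Data.Product using (_×_; _,_; proj₁; proj₂)
open import Data.Empty using (⊥-elim)
open import Relation.Binary.PropositionalEquality
open import Relation.Nullary using (¬_; yes; no)
open import Relation.Nullary.Decidable using (decidable-stable)
open import Function.Bundles using (_↔_; Inverse; mk⇔; Equivalence)
open import Function.Construct.Symmetry using (↔-sym)
open import Algebra.Bundles using (CommutativeRing)
import Algebra.Properties.CommutativeMonoid.Sum as MonoidSum
import Algebra.Properties.CommutativeSemigroup as SemigroupProperties

module GF2 = CommutativeRing BoolP.xor-∧-commutativeRing
open MonoidSum GF2.+-commutativeMonoid using (sum; sum-cong-≗; sum-permute)
open SemigroupProperties GF2.+-commutativeSemigroup using (interchange)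

vec-ext : ∀ {n} {x y : GF2^ n} → (∀ i → lookup x i ≡ lookup y i) → x ≡ y
vec-ext {x = x} {y} p = trans (sym (tabulate∘lookup x)) (trans (tabulate-cong p) (tabulate∘lookup y))

lookup-+v : ∀ {n} (x y : GF2^ n) i → lookup (x +v y) i ≡ lookup x i xor lookup y i
lookup-+v x y i = lookup-zipWith _xor_ i x y

lookup-0v : ∀ {n} (i : Fin n) → lookup (0v {n}) i ≡ false
lookup-0v i = lookup-replicate i false

+v-self : ∀ {n} (x : GF2^ n) → x +v x ≡ 0v
+v-self []      = refl
+v-self (a ∷ x) = cong₂ _∷_ (xor-same a) (+v-self x)

+v-cancelʳ : ∀ {n} (x y : GF2^ n) → (x +v y) +v y ≡ x
+v-cancelʳ x y = begin
  (x +v y) +v y  ≡⟨ zipWith-assoc xor-assoc x y y ⟩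
  x +v (y +v y)  ≡⟨ cong (x +v_) (+v-self y) ⟩
  x +v 0v        ≡⟨ zipWith-identityʳ xor-identityʳ x ⟩
  x              ∎
  where open ≡-Reasoning

+v≡0⇒≡ : ∀ {n} (x y : GF2^ n) → x +v y ≡ 0v → x ≡ y
+v≡0⇒≡ x y x+y≡0 = begin
  x              ≡⟨ sym (+v-cancelʳ x y) ⟩
  (x +v y) +v y  ≡⟨ cong (_+v y) x+y≡0 ⟩
  0v +v y        ≡⟨ zipWith-identityˡ xor-identityˡ y ⟩
  y              ∎
  where open ≡-Reasoning

b-sum : ∀ {n} (x y : GF2^ n) → b x y ≡ sum (λ i → lookup x i ∧ lookup y i)
b-sum []      []      = refl
b-sum (a ∷ x) (c ∷ y) = cong ((a ∧ c) xor_) (b-sum x y)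

b-linearˡ : ∀ {n} (x y v : GF2^ n) → b (x +v y) v ≡ b x v xor b y v
b-linearˡ []      []      []      = refl
b-linearˡ (a ∷ x) (c ∷ y) (d ∷ v) = begin
  ((a xor c) ∧ d) xor b (x +v y) v
    ≡⟨ cong₂ _xor_ (∧-distribʳ-xor d a c) (b-linearˡ x y v) ⟩
  ((a ∧ d) xor (c ∧ d)) xor (b x v xor b y v)
    ≡⟨ interchange (a ∧ d) (c ∧ d) (b x v) (b y v) ⟩
  ((a ∧ d) xor b x v) xor ((c ∧ d) xor b y v) ∎
  where open ≡-Reasoning

b-0ʳ : ∀ {n} (x : GF2^ n) → b x 0v ≡ false
b-0ʳ []      = refl
b-0ʳ (a ∷ x) = cong₂ _xor_ (∧-zeroʳ a) (b-0ʳ x)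

unit : ∀ {n} → Fin n → GF2^ n
unit zero    = true ∷ 0v
unit (suc f) = false ∷ unit f

b-unitʳ : ∀ {n} (x : GF2^ n) f → b x (unit f) ≡ lookup x f
b-unitʳ (a ∷ x) zero    = trans (cong₂ _xor_ (∧-identityʳ a) (b-0ʳ x)) (xor-identityʳ a)
b-unitʳ (a ∷ x) (suc f) = cong₂ _xor_ (∧-zeroʳ a) (b-unitʳ x f)

_≐_ : ∀ {n} → Matrix n → Matrix n → Set
P ≐ P' = ∀ i f → P i f ≡ P' i f

matrix-ext : ∀ {n} (P P' : Matrix n) → (∀ x → P · x ≡ P' · x) → P ≐ P'
matrix-ext P P' same i f = trans (sym (entry P)) (trans (cong (λ y → lookup y i) (same (unit f))) (entry P'))
  where
  entry : (R : Matrix _) → lookup (R · unit f) i ≡ R i f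
  entry R = trans (lookup∘tabulate _ i) (trans (b-unitʳ (tabulate (R i)) f) (lookup∘tabulate (R i) f))

⊆⇒lookup : ∀ {n} {x y : GF2^ n} → x ⊆ y → ∀ i → lookup x i ≡ true → lookup y i ≡ true
⊆⇒lookup {x = x} {y} x⊆y i xᵢ = []=⇒lookup (x⊆y (lookup⇒[]= i x xᵢ))

lookup⇒⊆ : ∀ {n} {x y : GF2^ n} → (∀ i → lookup x i ≡ true → lookup y i ≡ true) → x ⊆ y
lookup⇒⊆ {x = x} {y} h {i} i∈x = lookup⇒[]= i y (h i ([]=⇒lookup i∈x))

⊊⇒∣∣< : ∀ {n} (p q : Subset n) → p ⊆ q → p ≢ q → ∣ p ∣ < ∣ q ∣
⊊⇒∣∣< []          []          _   p≢q = ⊥-elim (p≢q refl)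
⊊⇒∣∣< (false ∷ p) (false ∷ q) p⊆q p≢q = ⊊⇒∣∣< p q (drop-∷-⊆ p⊆q) (λ e → p≢q (cong (false ∷_) e))
⊊⇒∣∣< (false ∷ p) (true ∷ q)  p⊆q _   = s≤s (p⊆q⇒∣p∣≤∣q∣ (drop-∷-⊆ p⊆q))
⊊⇒∣∣< (true ∷ p)  (false ∷ q) p⊆q _   with () ← []=⇒lookup (p⊆q here)
⊊⇒∣∣< (true ∷ p)  (true ∷ q)  p⊆q p≢q = s≤s (⊊⇒∣∣< p q (drop-∷-⊆ p⊆q) (λ e → p≢q (cong (true ∷_) e)))

+v-⊆ : ∀ {n} (v w : GF2^ n) → w ⊆ v → v +v w ⊆ v
+v-⊆ v w w⊆v = lookup⇒⊆ λ i h → xor-true (lookup v i) (lookup w i) (⊆⇒lookup w⊆v i) (trans (sym (lookup-+v v w i)) h)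
  where
  xor-true : ∀ a c → (c ≡ true → a ≡ true) → a xor c ≡ true → a ≡ true
  xor-true true  _ _ _ = refl
  xor-true false _ h e = h e

+v-≢ : ∀ {n} (v w : GF2^ n) → w ≢ 0v → v +v w ≢ v
+v-≢ v w w≢0 v+w≡v = w≢0 (begin
  w              ≡⟨ sym (zipWith-identityˡ xor-identityˡ w) ⟩
  0v +v w        ≡⟨ cong (_+v w) (sym (+v-self v)) ⟩
  (v +v v) +v w  ≡⟨ zipWith-assoc xor-assoc v v w ⟩
  v +v (v +v w)  ≡⟨ cong (v +v_) v+w≡v ⟩
  v +v v         ≡⟨ +v-self v ⟩
  0v             ∎)
  where open ≡-Reasoning

relabelMatrix : ∀ {n m} → Fin n ↔ Fin m → Matrix n → Matrix m
relabelMatrix σ Q j k = Q (Inverse.from σ j) (Inverse.from σ k)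

module Relabel {n m : ℕ} (σ : Fin n ↔ Fin m) where
  private
    to   = Inverse.to σ
    from = Inverse.from σ
    σ⁻¹  = ↔-sym σ

  lookup-image : ∀ (v : GF2^ n) j → lookup (image σ v) j ≡ lookup v (from j)
  lookup-image v j = lookup∘tabulate _ j

  image-+v : ∀ (x y : GF2^ n) → image σ (x +v y) ≡ image σ x +v image σ y
  image-+v x y = vec-ext λ j → begin
    lookup (image σ (x +v y)) j              ≡⟨ lookup-image (x +v y) j ⟩
    lookup (x +v y) (from j)                 ≡⟨ lookup-+v x y (from j) ⟩
    lookup x (from j) xor lookup y (from j)  ≡⟨ sym (cong₂ _xor_ (lookup-image x j) (lookup-image y j)) ⟩
    lookup (image σ x) j xor lookup (image σ y) j ≡⟨ sym (lookup-+v (image σ x) (image σ y) j) ⟩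
    lookup (image σ x +v image σ y) j        ∎
    where open ≡-Reasoning

  image-0v : image σ 0v ≡ 0v
  image-0v = vec-ext λ j → trans (lookup-image 0v j) (trans (lookup-0v (from j)) (sym (lookup-0v j)))

  image-inverseˡ : ∀ (v : GF2^ n) → image σ⁻¹ (image σ v) ≡ v
  image-inverseˡ v = vec-ext λ i → begin
    lookup (image σ⁻¹ (image σ v)) i  ≡⟨ lookup∘tabulate _ i ⟩
    lookup (image σ v) (to i)         ≡⟨ lookup-image v (to i) ⟩
    lookup v (from (to i))            ≡⟨ cong (lookup v) (Inverse.strictlyInverseʳ σ i) ⟩
    lookup v i                        ∎
    where open ≡-Reasoning

  image-⊆ : ∀ {x y : GF2^ n} → x ⊆ y → image σ x ⊆ image σ y
  image-⊆ {x} {y} x⊆y = lookup⇒⊆ λ j h →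
    trans (lookup-image y j) (⊆⇒lookup x⊆y (from j) (trans (sym (lookup-image x j)) h))

  b-image : ∀ (x y : GF2^ n) → b (image σ x) (image σ y) ≡ b x y
  b-image x y = begin
    b (image σ x) (image σ y)                               ≡⟨ b-sum (image σ x) (image σ y) ⟩
    sum (λ j → lookup (image σ x) j ∧ lookup (image σ y) j) ≡⟨ sum-cong-≗ (λ j → cong₂ _∧_ (lookup-image x j) (lookup-image y j)) ⟩
    sum (λ j → lookup x (from j) ∧ lookup y (from j))       ≡⟨ sym (sum-permute (λ i → lookup x i ∧ lookup y i) σ⁻¹) ⟩
    sum (λ i → lookup x i ∧ lookup y i)                     ≡⟨ sym (b-sum x y) ⟩
    b x y                                                   ∎
    where open ≡-Reasoning

  relabelMatrix-· : ∀ (Q : Matrix n) (x : GF2^ n) → relabelMatrix σ Q · image σ x ≡ image σ (Q · x)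
  relabelMatrix-· Q x = vec-ext λ j → begin
    lookup (relabelMatrix σ Q · image σ x) j           ≡⟨ lookup∘tabulate _ j ⟩
    b (tabulate (relabelMatrix σ Q j)) (image σ x)     ≡⟨ cong (λ r → b r (image σ x)) (tabulate-cong λ k → sym (lookup∘tabulate (Q (from j)) (from k))) ⟩
    b (image σ (tabulate (Q (from j)))) (image σ x)    ≡⟨ b-image (tabulate (Q (from j))) x ⟩
    b (tabulate (Q (from j))) x                        ≡⟨ sym (lookup∘tabulate (λ i → b (tabulate (Q i)) x) (from j)) ⟩
    lookup (Q · x) (from j)                            ≡⟨ sym (lookup-image (Q · x) j) ⟩
    lookup (image σ (Q · x)) j                         ∎
    where open ≡-Reasoning

open Relabel

image-inverseʳ : ∀ {n m} (σ : Fin n ↔ Fin m) (w : GF2^ m) → image σ (image (↔-sym σ) w) ≡ w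
image-inverseʳ σ = image-inverseˡ (↔-sym σ)

image-≢0 : ∀ {n m} (σ : Fin n ↔ Fin m) (v : GF2^ n) → v ≢ 0v → image σ v ≢ 0v
image-≢0 σ v v≢0 σv≡0 = v≢0 (begin
  v                             ≡⟨ sym (image-inverseˡ σ v) ⟩
  image (↔-sym σ) (image σ v)   ≡⟨ cong (image (↔-sym σ)) σv≡0 ⟩
  image (↔-sym σ) 0v            ≡⟨ image-0v (↔-sym σ) ⟩
  0v                            ∎)
  where open ≡-Reasoning

·-cong : ∀ {n} {P P' : Matrix n} → P ≐ P' → ∀ x → P · x ≡ P' · x
·-cong P≐P' x = tabulate-cong λ i → cong (λ r → b r x) (tabulate-cong (P≐P' i))

xor≡false⇒≡ : ∀ a c → a xor c ≡ false → a ≡ c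
xor≡false⇒≡ false false _ = refl
xor≡false⇒≡ true  true  _ = refl
xor≡false⇒≡ false true  ()
xor≡false⇒≡ true  false ()

module Projection {n} (V : Subspace n) (pedestrian : Pedestrian V) where

  -- A projection matrix fixes V pointwise, since v + Qv lies in V ∩ V⊥ = {0}.
  fixes : ∀ {Q} → IsProjectionMatrix V Q → ∀ v → v ∈V V → Q · v ≡ v
  fixes {Q} projQ v v∈V = sym (+v≡0⇒≡ v (Q · v)
    (pedestrian _ (mem-+ V v (Q · v) v∈V (proj₁ (projQ v))) (proj₂ (projQ v))))

  -- The projection matrix of a pedestrian subspace is unique: for every x,
  -- Px + P'x lies in V and pairs with V exactly like x + x = 0 does.
  unique : ∀ {P P'} → IsProjectionMatrix V P → IsProjectionMatrix V P' → P ≐ P'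
  unique {P} {P'} projP projP' = matrix-ext P P' λ x →
    +v≡0⇒≡ _ _ (pedestrian _ (mem-+ V _ _ (proj₁ (projP x)) (proj₁ (projP' x))) (⊥-difference x))
    where
    pairs-like : ∀ {R} → IsProjectionMatrix V R → ∀ x v → v ∈V V → b x v ≡ b (R · x) v
    pairs-like {R} projR x v v∈V =
      xor≡false⇒≡ _ _ (trans (sym (b-linearˡ x (R · x) v)) (proj₂ (projR x) v v∈V))

    ⊥-difference : ∀ x → ((P · x) +v (P' · x)) ∈V⊥ V
    ⊥-difference x v v∈V = begin
      b ((P · x) +v (P' · x)) v     ≡⟨ b-linearˡ (P · x) (P' · x) v ⟩
      b (P · x) v xor b (P' · x) v  ≡⟨ sym (cong₂ _xor_ (pairs-like projP x v v∈V) (pairs-like projP' x v v∈V)) ⟩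
      b x v xor b x v               ≡⟨ xor-same (b x v) ⟩
      false                         ∎
      where open ≡-Reasoning

Carries : ∀ {n m} → Fin n ↔ Fin m → Subspace n → Subspace m → Set
Carries σ V V' = ∀ v → v ∈V V → image σ v ∈V V'

Relabels : ∀ {n m} → Fin n ↔ Fin m → Subspace n → Subspace m → Set
Relabels σ V V' = Carries σ V V' × Carries (↔-sym σ) V' V

relabelMatrix-projection : ∀ {n m} (σ : Fin n ↔ Fin m) (V : Subspace n) (V' : Subspace m) →
  Relabels σ V V' → (Q : Matrix n) → IsProjectionMatrix V Q → IsProjectionMatrix V' (relabelMatrix σ Q)
relabelMatrix-projection σ V V' (carries , carries⁻¹) Q projQ x =
  subst (λ z → ((R · z) ∈V V') × ((z +v (R · z)) ∈V⊥ V')) (image-inverseʳ σ x) (projects (image (↔-sym σ) x))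
  where
  R = relabelMatrix σ Q

  projects : ∀ y → ((R · image σ y) ∈V V') × ((image σ y +v (R · image σ y)) ∈V⊥ V')
  projects y rewrite relabelMatrix-· σ Q y = carries _ (proj₁ (projQ y)) , ⊥-rest
    where
    ⊥-rest : (image σ y +v image σ (Q · y)) ∈V⊥ V'
    ⊥-rest w w∈V' = begin
      b (image σ y +v image σ (Q · y)) w
        ≡⟨ cong₂ b (sym (image-+v σ y (Q · y))) (sym (image-inverseʳ σ w)) ⟩
      b (image σ (y +v (Q · y))) (image σ (image (↔-sym σ) w))
        ≡⟨ b-image σ (y +v (Q · y)) (image (↔-sym σ) w) ⟩
      b (y +v (Q · y)) (image (↔-sym σ) w)
        ≡⟨ proj₂ (projQ y) _ (carries⁻¹ w w∈V') ⟩
      false ∎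
      where open ≡-Reasoning

relabels⇒conjugate : ∀ {n m} (σ : Fin n ↔ Fin m) (V : Subspace n) (V' : Subspace m) →
  Pedestrian V' → (Q : Matrix n) (Q' : Matrix m) →
  IsProjectionMatrix V Q → IsProjectionMatrix V' Q' →
  Relabels σ V V' → Q' ≐ relabelMatrix σ Q
relabels⇒conjugate σ V V' pedestrian' Q Q' projQ projQ' relabels =
  Projection.unique V' pedestrian' projQ' (relabelMatrix-projection σ V V' relabels Q projQ)

conjugate-sym : ∀ {n m} (σ : Fin n ↔ Fin m) (Q : Matrix n) (Q' : Matrix m) →
  Q' ≐ relabelMatrix σ Q → Q ≐ relabelMatrix (↔-sym σ) Q'
conjugate-sym σ Q Q' conj e f = sym (trans (conj (Inverse.to σ e) (Inverse.to σ f))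
  (cong₂ Q (Inverse.strictlyInverseʳ σ e) (Inverse.strictlyInverseʳ σ f)))

-- V is the fixed space of Q, so Q' = σ Q σ⁻¹ forces σ to map V into V'.
conjugate⇒carries : ∀ {n m} (σ : Fin n ↔ Fin m) (V : Subspace n) (V' : Subspace m) →
  Pedestrian V → (Q : Matrix n) (Q' : Matrix m) →
  IsProjectionMatrix V Q → IsProjectionMatrix V' Q' →
  Q' ≐ relabelMatrix σ Q → Carries σ V V'
conjugate⇒carries σ V V' pedestrian Q Q' projQ projQ' conj v v∈V =
  subst (_∈V V') fixed (proj₁ (projQ' (image σ v)))
  where
  fixed : Q' · image σ v ≡ image σ v
  fixed = begin
    Q' · image σ v                 ≡⟨ ·-cong conj (image σ v) ⟩
    relabelMatrix σ Q · image σ v  ≡⟨ relabelMatrix-· σ Q v ⟩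
    image σ (Q · v)                ≡⟨ cong (image σ) (Projection.fixes V pedestrian projQ v v∈V) ⟩
    image σ v                      ∎
    where open ≡-Reasoning

conjugate⇒relabels : ∀ {n m} (σ : Fin n ↔ Fin m) (V : Subspace n) (V' : Subspace m) →
  Pedestrian V → Pedestrian V' → (Q : Matrix n) (Q' : Matrix m) →
  IsProjectionMatrix V Q → IsProjectionMatrix V' Q' →
  Q' ≐ relabelMatrix σ Q → Relabels σ V V'
conjugate⇒relabels σ V V' pedestrian pedestrian' Q Q' projQ projQ' conj =
  conjugate⇒carries σ V V' pedestrian Q Q' projQ projQ' conj ,
  conjugate⇒carries (↔-sym σ) V' V pedestrian' Q' Q projQ' projQ (conjugate-sym σ Q Q' conj)

-- Over GF(2) an edge-preserving bijection of support graphs is exactly a conjugation.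
edges⇔conjugate : ∀ {n m} (σ : Fin n ↔ Fin m) (Q : Matrix n) (Q' : Matrix m) →
  (∀ e f → Edge Q e f ⇔ Edge Q' (Inverse.to σ e) (Inverse.to σ f)) ⇔ (Q' ≐ relabelMatrix σ Q)
edges⇔conjugate σ Q Q' = mk⇔ edges⇒conjugate conjugate⇒edges
  where
  open Inverse σ using (to; from; strictlyInverseˡ)

  edges⇒conjugate : (∀ e f → Edge Q e f ⇔ Edge Q' (to e) (to f)) → Q' ≐ relabelMatrix σ Q
  edges⇒conjugate edges j k = begin
    Q' j k                        ≡⟨ sym (cong₂ Q' (strictlyInverseˡ j) (strictlyInverseˡ k)) ⟩
    Q' (to (from j)) (to (from k)) ≡⟨ sym (⇔→≡ (edges (from j) (from k))) ⟩
    Q (from j) (from k)           ∎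
    where open ≡-Reasoning

  conjugate⇒edges : Q' ≐ relabelMatrix σ Q → ∀ e f → Edge Q e f ⇔ Edge Q' (to e) (to f)
  conjugate⇒edges conj e f = mk⇔ (trans (sym same)) (trans same)
    where
    same : Q e f ≡ Q' (to e) (to f)
    same = conjugate-sym σ Q Q' conj e f

PreservesIndependence : ∀ {n m} → Fin n ↔ Fin m → Subspace n → Subspace m → Set
PreservesIndependence σ V V' = ∀ F → Independent V F ⇔ Independent V' (image σ F)

preservesIndependence-sym : ∀ {n m} (σ : Fin n ↔ Fin m) (V : Subspace n) (V' : Subspace m) →
  PreservesIndependence σ V V' → PreservesIndependence (↔-sym σ) V' V
preservesIndependence-sym σ V V' iso G = mk⇔
  (λ ind' → Equivalence.from (iso (image (↔-sym σ) G)) (subst (Independent V') (sym (image-inverseʳ σ G)) ind'))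
  (λ ind → subst (Independent V') (image-inverseʳ σ G) (Equivalence.to (iso (image (↔-sym σ) G)) ind))

-- A vector of V whose image lies outside V' would be a dependency in M(V) with
-- an independent image in M(V').
relabels⇒preservesIndependence : ∀ {n m} (σ : Fin n ↔ Fin m) (V : Subspace n) (V' : Subspace m) →
  Relabels σ V V' → PreservesIndependence σ V V'
relabels⇒preservesIndependence σ V V' (carries , carries⁻¹) F = mk⇔ forward backward
  where
  σ⁻¹ = ↔-sym σ

  forward : Independent V F → Independent V' (image σ F)
  forward ind w w∈V' w≢0 w⊆σF = ind (image σ⁻¹ w) (carries⁻¹ w w∈V') (image-≢0 σ⁻¹ w w≢0)
    (subst (image σ⁻¹ w ⊆_) (image-inverseˡ σ F) (image-⊆ σ⁻¹ w⊆σF))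

  backward : Independent V' (image σ F) → Independent V F
  backward ind' v v∈V v≢0 v⊆F = ind' (image σ v) (carries v v∈V) (image-≢0 σ v v≢0) (image-⊆ σ v⊆F)

CircuitVector : ∀ {n} → Subspace n → GF2^ n → Set
CircuitVector V v = ∀ w → w ∈V V → w ≢ 0v → w ⊆ v → w ≡ v

∈V-stable : ∀ {n} (V : Subspace n) x → ¬ ¬ (x ∈V V) → x ∈V V
∈V-stable V x = decidable-stable (mem V x Bool.≟ true)

module FromIndependence {n m : ℕ} (σ : Fin n ↔ Fin m) (V : Subspace n) (V' : Subspace m)
                        (iso : PreservesIndependence σ V V') where
  private
    σ⁻¹ = ↔-sym σ

  -- If the image of a circuit vector v were outside V', then σ(supp v) would be
  -- independent in M(V'): a nonzero u' ∈ V' inside it pulls back to u ⊆ v which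
  -- (being dependent) contains a nonzero vector of V, necessarily v, so u' = σv.
  circuit-carried : ∀ v → v ∈V V → v ≢ 0v → CircuitVector V v → ¬ ¬ (image σ v ∈V V')
  circuit-carried v v∈V v≢0 circuit σv∉V' = dependent independent
    where
    dependent : ¬ Independent V' (image σ v)
    dependent ind' = Equivalence.from (iso v) ind' v v∈V v≢0 ⊆-refl

    independent : Independent V' (image σ v)
    independent u' u'∈V' u'≢0 u'⊆σv = Equivalence.to (iso u) u-independent u' u'∈V' u'≢0 u'⊆σu
      where
      u = image σ⁻¹ u'
      u⊆v : u ⊆ v
      u⊆v = subst (u ⊆_) (image-inverseˡ σ v) (image-⊆ σ⁻¹ u'⊆σv)
      u'⊆σu : u' ⊆ image σ u
      u'⊆σu = subst (u' ⊆_) (sym (image-inverseʳ σ u')) ⊆-refl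

      u-independent : Independent V u
      u-independent w w∈V w≢0 w⊆u = σv∉V' (subst (_∈V V') u'≡σv u'∈V')
        where
        u≡v : u ≡ v
        u≡v = ⊆-antisym u⊆v (subst (_⊆ u) (circuit w w∈V w≢0 (⊆-trans w⊆u u⊆v)) w⊆u)
        u'≡σv : u' ≡ image σ v
        u'≡σv = trans (sym (image-inverseʳ σ u')) (cong (image σ) u≡v)

  CarriesSize : ℕ → Set
  CarriesSize k = ∀ v → ∣ v ∣ ≡ k → v ∈V V → image σ v ∈V V'

  -- Strong induction step: a nonzero v whose image is outside V' is a circuit
  -- vector, because any proper nonzero w ⊆ v in V splits v = w + (v + w) into
  -- two vectors of smaller support whose images lie in V'.
  carries-step : ∀ k → (∀ {j} → j < k → CarriesSize j) → CarriesSize k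
  carries-step k smaller v refl v∈V with ≡-dec Bool._≟_ v 0v
  ... | yes v≡0 = subst (λ z → image σ z ∈V V') (sym v≡0) (subst (_∈V V') (sym (image-0v σ)) (mem-0 V'))
  ... | no  v≢0 = ∈V-stable V' (image σ v) λ σv∉V' → circuit-carried v v∈V v≢0 (circuit σv∉V') σv∉V'
    where
    circuit : ¬ (image σ v ∈V V') → CircuitVector V v
    circuit σv∉V' w w∈V w≢0 w⊆v with ≡-dec Bool._≟_ w v
    ... | yes w≡v = w≡v
    ... | no  w≢v = ⊥-elim (σv∉V' (subst (_∈V V') split (mem-+ V' _ _ σ[v+w]∈V' σw∈V')))
      where
      σw∈V' : image σ w ∈V V'
      σw∈V' = smaller (⊊⇒∣∣< w v w⊆v w≢v) w refl w∈V
      σ[v+w]∈V' : image σ (v +v w) ∈V V'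
      σ[v+w]∈V' = smaller (⊊⇒∣∣< (v +v w) v (+v-⊆ v w w⊆v) (+v-≢ v w w≢0)) (v +v w) refl (mem-+ V v w v∈V w∈V)
      split : image σ (v +v w) +v image σ w ≡ image σ v
      split = trans (sym (image-+v σ (v +v w) w)) (cong (image σ) (+v-cancelʳ v w))

  carries : Carries σ V V'
  carries v = <-rec CarriesSize carries-step ∣ v ∣ v refl

preservesIndependence⇒relabels : ∀ {n m} (σ : Fin n ↔ Fin m) (V : Subspace n) (V' : Subspace m) →
  PreservesIndependence σ V V' → Relabels σ V V'
preservesIndependence⇒relabels σ V V' iso =
  FromIndependence.carries σ V V' iso ,
  FromIndependence.carries (↔-sym σ) V' V (preservesIndependence-sym σ V V' iso)

theorem7 : ∀ {n n'} (V : Subspace n) (V' : Subspace n') →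
    Pedestrian V → Pedestrian V' →
    (Q : Matrix n) (Q' : Matrix n') →
    IsProjectionMatrix V Q → IsProjectionMatrix V' Q' →
    MatroidIso V V' ⇔ GraphIso Q Q'
theorem7 V V' pedestrian pedestrian' Q Q' projQ projQ' = mk⇔ matroid⇒graph graph⇒matroid
  where
  matroid⇒graph : MatroidIso V V' → GraphIso Q Q'
  matroid⇒graph (σ , iso) = σ , Equivalence.from (edges⇔conjugate σ Q Q')
    (relabels⇒conjugate σ V V' pedestrian' Q Q' projQ projQ'
      (preservesIndependence⇒relabels σ V V' iso))

  graph⇒matroid : GraphIso Q Q' → MatroidIso V V'
  graph⇒matroid (σ , edges) = σ , relabels⇒preservesIndependence σ V V'
    (conjugate⇒relabels σ V V' pedestrian pedestrian' Q Q' projQ projQ'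
      (Equivalence.to (edges⇔conjugate σ Q Q') edges))
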